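{- There are infinitely many pairs $(b,y)$ of integers with $b\ge 2$, $y\ge 1$, for which there exists a word $w$ over $\{0,1,\dots,b-1\}$ with $|w|=2$ such that $(y^2)_b = w\uparrow 3$; equivalently, infinitely many positive integer solutions $(b,y,c)$ of $y^2=c(b^4+b^2+1)$ with $b\le c<b^2$.
   Context: $(m)_b$ denotes the canonical base-$b$ representation of the integer $m$ (no leading zeros); $|w|$ is the length of the word $w$ and $w\uparrow n$ is the concatenation of $n$ copies of $w$. -}

module Defs where

open import Data.Nat using (ℕ; zero; suc; _+_; _*_; _<_)
open import Data.List using (List; []; _∷_; _++_; foldl)
open import Data.List.Relation.Unary.All using (All)
open import Relation.Binary.PropositionalEquality using (_≡_)
open import Data.Product using (_×_)

evalDigits : ℕ → List ℕ → ℕ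
evalDigits b ds = foldl (λ acc d → acc * b + d) 0 ds

data LeadingNonzero : List ℕ → Set where
  lead : ∀ {d ds} → 0 < d → LeadingNonzero (d ∷ ds)

-- ds is the canonical base-b representation (m)_b of m:
-- digits from {0,…,b-1}, no leading zeros, and value m.
-- (For m ≥ 1 and b ≥ 2 this representation exists and is unique.)
IsBaseRepr : ℕ → ℕ → List ℕ → Set
IsBaseRepr b m ds = All (λ d → d < b) ds × LeadingNonzero ds × evalDigits b ds ≡ m

_↑_ : {A : Set} → List A → ℕ → List A
w ↑ zero = []
w ↑ suc n = w ++ (w ↑ n)

{-# OPTIONS --safe #-}
module Submission where

open import Defs
open import Data.Nat using (ℕ; zero; suc; _+_; _*_; _≤_; _<_; z≤n; s≤s)
open import Data.Nat.Properties
  using (m≤m+n; m≤n+m; m≤n*m; ≤-trans; +-comm; +-cancelʳ-≡; *-mono-≤; *-monoˡ-≤; +-mono-≤-<; ≤ᵇ⇒≤; <ᵇ⇒<)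
open import Data.Nat.GeneralisedArithmetic using (fold)
open import Data.Nat.Tactic.RingSolver using (solve-∀)
open import Data.List using (List; []; _∷_; length)
open import Data.List.Relation.Unary.All using (All; []; _∷_)
open import Data.List.Relation.Unary.All.Properties using (++⁺)
open import Data.Product using (_×_; _,_; proj₁; proj₂; ∃-syntax)
open import Relation.Nullary using (contradiction)
open import Relation.Binary.PropositionalEquality
  using (_≡_; refl; trans; cong; cong₂; subst; module ≡-Reasoning)

-- Write b = 49m + 19 and suppose b² + b + 1 = 3u².  Then
-- b⁴ + b² + 1 = (b² + b + 1)(b² − b + 1) = 3u² · 49q with q = 49m² + 37m + 7,
-- and the two-digit word w = (3m + 1, 5m + 2) has value 3q, so w↑3 has value
-- 3q(b⁴ + b² + 1) = (21uq)².  The equation b² + b + 1 = 3u² is preserved by the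
-- map (b, u) ↦ (7b + 12u + 3, 4b + 7u + 2), whose 28th iterate is the
-- identity modulo 49; iterating it from (313, 181) gives infinitely many b ≡ 19 (mod 49).

PellSolution : ℕ × ℕ → Set
PellSolution (b , u) = b * b + b + 1 ≡ 3 * (u * u)

pellStep : ℕ × ℕ → ℕ × ℕ
pellStep (b , u) = 7 * b + 12 * u + 3 , 4 * b + 7 * u + 2

pellStep-preserves : ∀ p → PellSolution p → PellSolution (pellStep p)
pellStep-preserves (b , u) sol = +-cancelʳ-≡ (3 * (u * u)) _ _ (begin
  b′ * b′ + b′ + 1 + 3 * (u * u)  ≡⟨ exchange b u ⟩
  b * b + b + 1 + 3 * (u′ * u′)   ≡⟨ cong (_+ 3 * (u′ * u′)) sol ⟩
  3 * (u * u) + 3 * (u′ * u′)     ≡⟨ +-comm (3 * (u * u)) _ ⟩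
  3 * (u′ * u′) + 3 * (u * u)     ∎)
  where
  open ≡-Reasoning
  b′ = 7 * b + 12 * u + 3
  u′ = 4 * b + 7 * u + 2
  exchange : ∀ b u → let b′ = 7 * b + 12 * u + 3 ; u′ = 4 * b + 7 * u + 2 in
             b′ * b′ + b′ + 1 + 3 * (u * u) ≡ b * b + b + 1 + 3 * (u′ * u′)
  exchange = solve-∀

pellIterate : ℕ → ℕ × ℕ → ℕ × ℕ
pellIterate n p = fold p pellStep n

pellIterate-preserves : ∀ n p → PellSolution p → PellSolution (pellIterate n p)
pellIterate-preserves zero    p sol = sol
pellIterate-preserves (suc n) p sol = pellStep-preserves (pellIterate n p) (pellIterate-preserves n p sol)

AffineForm : Set
AffineForm = ℕ × ℕ × ℕ

⟦_⟧ : AffineForm → ℕ × ℕ → ℕ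
⟦ β , γ , κ ⟧ (b , u) = β * b + γ * u + κ

⟦_⟧² : AffineForm × AffineForm → ℕ × ℕ → ℕ × ℕ
⟦ f , g ⟧² p = ⟦ f ⟧ p , ⟦ g ⟧ p

formStep : AffineForm × AffineForm → AffineForm × AffineForm
formStep ((β , γ , κ) , (β′ , γ′ , κ′)) =
  (7 * β + 12 * β′ , 7 * γ + 12 * γ′ , 7 * κ + 12 * κ′ + 3) ,
  (4 * β + 7 * β′ , 4 * γ + 7 * γ′ , 4 * κ + 7 * κ′ + 2)

pellStep-⟦⟧² : ∀ F p → pellStep (⟦ F ⟧² p) ≡ ⟦ formStep F ⟧² p
pellStep-⟦⟧² ((β , γ , κ) , (β′ , γ′ , κ′)) (b , u) =
  cong₂ _,_ (first β γ κ β′ γ′ κ′ b u) (second β γ κ β′ γ′ κ′ b u)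
  where
  first : ∀ β γ κ β′ γ′ κ′ b u →
    7 * (β * b + γ * u + κ) + 12 * (β′ * b + γ′ * u + κ′) + 3
      ≡ (7 * β + 12 * β′) * b + (7 * γ + 12 * γ′) * u + (7 * κ + 12 * κ′ + 3)
  first = solve-∀
  second : ∀ β γ κ β′ γ′ κ′ b u →
    4 * (β * b + γ * u + κ) + 7 * (β′ * b + γ′ * u + κ′) + 2
      ≡ (4 * β + 7 * β′) * b + (4 * γ + 7 * γ′) * u + (4 * κ + 7 * κ′ + 2)
  second = solve-∀

formIterate : ℕ → AffineForm × AffineForm
formIterate n = fold ((1 , 0 , 0) , (0 , 1 , 0)) formStep n

pellIterate-affine : ∀ n p → pellIterate n p ≡ ⟦ formIterate n ⟧² p
pellIterate-affine zero    (b , u) = cong₂ _,_ (identityᵇ b u) (identityᵘ b u)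
  where
  identityᵇ : ∀ b u → b ≡ 1 * b + 0 * u + 0
  identityᵇ = solve-∀
  identityᵘ : ∀ b u → u ≡ 0 * b + 1 * u + 0
  identityᵘ = solve-∀
pellIterate-affine (suc n) p = trans (cong pellStep (pellIterate-affine n p))
                                     (pellStep-⟦⟧² (formIterate n) p)

base : ℕ → ℕ
base m = 49 * m + 19

-- Stated for an arbitrary number of steps: with the literal 28, Agda would unfold
-- pellIterate on open terms, which duplicates b and u exponentially.
pellIterate-base : ∀ n {x y z} → proj₁ (formIterate n) ≡ (1 + 49 * x , 49 * y , 49 * suc z) →
  ∀ m u → proj₁ (pellIterate n (base m , u)) ≡ base (suc (m + (x * base m + y * u + z)))
pellIterate-base n {x} {y} {z} form₁ m u = begin
  proj₁ (pellIterate n (base m , u))              ≡⟨ cong proj₁ (pellIterate-affine n (base m , u)) ⟩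
  ⟦ proj₁ (formIterate n) ⟧ (base m , u)          ≡⟨ cong (λ f → ⟦ f ⟧ (base m , u)) form₁ ⟩
  (1 + 49 * x) * base m + 49 * y * u + 49 * suc z ≡⟨ collect x y z m u ⟩
  base (suc (m + (x * base m + y * u + z)))       ∎
  where
  open ≡-Reasoning
  collect : ∀ x y z m u →
    (1 + 49 * x) * (49 * m + 19) + 49 * y * u + 49 * suc z
      ≡ 49 * suc (m + (x * (49 * m + 19) + y * u + z)) + 19
  collect = solve-∀

IsIdentityMod49 : AffineForm → Set
IsIdentityMod49 f = ∃[ x ] ∃[ y ] ∃[ z ] f ≡ (1 + 49 * x , 49 * y , 49 * suc z)

formIterate-28-mod-49 : IsIdentityMod49 (proj₁ (formIterate 28))
formIterate-28-mod-49 =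
  1091029732824667960646346885504 , 1889718929820622572311819358768 ,
  545514866412333980323173442751 , refl

PellSolutionFrom : ℕ → Set
PellSolutionFrom n = ∃[ m ] ∃[ u ] (n ≤ m × PellSolution (base m , u))

larger-pellSolution : ∀ k → IsIdentityMod49 (proj₁ (formIterate k)) →
  ∀ {n} → PellSolutionFrom n → PellSolutionFrom (suc n)
larger-pellSolution k (x , y , z , form₁) (m , u , n≤m , sol) =
  suc (m + (x * base m + y * u + z)) , proj₂ (pellIterate k (base m , u)) ,
  s≤s (≤-trans n≤m (m≤m+n m _)) ,
  subst (λ b → PellSolution (b , proj₂ (pellIterate k (base m , u))))
        (pellIterate-base k {x} {y} {z} form₁ m u) (pellIterate-preserves k (base m , u) sol)

pellSolutions-unbounded : ∀ n → PellSolutionFrom n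
pellSolutions-unbounded zero    = 6 , 181 , z≤n , refl
pellSolutions-unbounded (suc n) = larger-pellSolution 28 formIterate-28-mod-49 (pellSolutions-unbounded n)

evalDigits-pair↑3 : ∀ b x y → evalDigits b ((x ∷ y ∷ []) ↑ 3) ≡ (x * b + y) * (b * b * b * b + b * b + 1)
evalDigits-pair↑3 = horner
  where
  horner : ∀ b x y → (((((0 * b + x) * b + y) * b + x) * b + y) * b + x) * b + y
                     ≡ (x * b + y) * (b * b * b * b + b * b + 1)
  horner = solve-∀

cofactor : ℕ → ℕ
cofactor m = 49 * m * m + 37 * m + 7

word : ℕ → List ℕ
word m = 3 * m + 1 ∷ 5 * m + 2 ∷ []

word-value : ∀ m → (3 * m + 1) * base m + (5 * m + 2) ≡ 3 * cofactor m
word-value = expanded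
  where
  expanded : ∀ m → (3 * m + 1) * (49 * m + 19) + (5 * m + 2) ≡ 3 * (49 * m * m + 37 * m + 7)
  expanded = solve-∀

-- b⁴ + b² + 1 = (b² + b + 1)(b² − b + 1), and b² − b + 1 = 49 q at b = 49m + 19.
base-sextic : ∀ m → let b = base m in b * b * b * b + b * b + 1 ≡ (b * b + b + 1) * (49 * cofactor m)
base-sextic = expanded
  where
  expanded : ∀ m → let b = 49 * m + 19 in
             b * b * b * b + b * b + 1 ≡ (b * b + b + 1) * (49 * (49 * m * m + 37 * m + 7))
  expanded = solve-∀

evalDigits-word↑3 : ∀ m u → PellSolution (base m , u) →
  evalDigits (base m) (word m ↑ 3) ≡ (21 * u * cofactor m) * (21 * u * cofactor m)
evalDigits-word↑3 m u sol = begin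
  evalDigits b (word m ↑ 3)
    ≡⟨ evalDigits-pair↑3 b (3 * m + 1) (5 * m + 2) ⟩
  ((3 * m + 1) * b + (5 * m + 2)) * (b * b * b * b + b * b + 1)
    ≡⟨ cong₂ _*_ (word-value m) (base-sextic m) ⟩
  3 * q * ((b * b + b + 1) * (49 * q))
    ≡⟨ cong (λ t → 3 * q * (t * (49 * q))) sol ⟩
  3 * q * (3 * (u * u) * (49 * q))
    ≡⟨ square u q ⟩
  (21 * u * q) * (21 * u * q)
    ∎
  where
  open ≡-Reasoning
  b = base m
  q = cofactor m
  square : ∀ u q → 3 * q * (3 * (u * u) * (49 * q)) ≡ (21 * u * q) * (21 * u * q)
  square = solve-∀

digit<base : ∀ {c d} m → c ≤ 49 → d < 19 → c * m + d < base m
digit<base m c≤49 d<19 = +-mono-≤-< (*-monoˡ-≤ m c≤49) d<19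

word-digits : ∀ m → All (_< base m) (word m)
word-digits m = digit<base m (≤ᵇ⇒≤ 3 49 _) (<ᵇ⇒< 1 19 _)
              ∷ digit<base m (≤ᵇ⇒≤ 5 49 _) (<ᵇ⇒< 2 19 _)
              ∷ []

cofactor>0 : ∀ m → 0 < cofactor m
cofactor>0 m = ≤-trans (≤ᵇ⇒≤ 1 7 _) (m≤n+m 7 (49 * m * m + 37 * m))

All-↑ : ∀ {A : Set} {P : A → Set} {w} n → All P w → All P (w ↑ n)
All-↑ zero    _  = []
All-↑ (suc n) ps = ++⁺ ps (All-↑ n ps)

pellSolution⇒u>0 : ∀ b u → PellSolution (b , u) → 0 < u
pellSolution⇒u>0 b zero    sol = contradiction (trans (+-comm 1 (b * b + b)) sol) λ ()
pellSolution⇒u>0 b (suc u) _   = s≤s z≤n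

mainTheorem9 : ∀ (N : ℕ) → ∃[ b ] ∃[ y ] (N ≤ b + y × 2 ≤ b × 1 ≤ y ×
                 ∃[ w ] (All (λ d → d < b) w × length w ≡ 2 × IsBaseRepr b (y * y) (w ↑ 3)))
mainTheorem9 N with pellSolutions-unbounded N
... | m , u , N≤m , sol =
  base m , y ,
  ≤-trans N≤m (≤-trans (m≤n*m m 49) (≤-trans (m≤m+n _ 19) (m≤m+n (base m) y))) ,
  ≤-trans (≤ᵇ⇒≤ 2 19 _) (m≤n+m 19 (49 * m)) ,
  *-mono-≤ (*-mono-≤ {1} {21} {1} {u} (≤ᵇ⇒≤ 1 21 _) (pellSolution⇒u>0 (base m) u sol)) (cofactor>0 m) ,
  word m , word-digits m , refl ,
  All-↑ 3 (word-digits m) , lead (m≤n+m 1 (3 * m)) , evalDigits-word↑3 m u sol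
  where
  y = 21 * u * cofactor m
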